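{- Let $p$ be a prime, $q$ a natural number, and let $G=(X\cup Y,E)$ be a bipartite graph with parts $X$ and $Y$, with $q$th color compatibility matrix $M$. Then the rank of $M$ over $\mathbb{F}_p$ satisfies \[ \mathrm{rank}_p(M)\leq \begin{cases}(q-1)^{|E|} & \text{if } p \text{ divides } q-1,\\ q^{|E|} & \text{otherwise.}\end{cases} \] Moreover, equality is achieved if $G$ is a perfect matching.
   Context: $[q]=\{1,\dots,q\}$. For the bipartite graph $(X\cup Y,E)$ (with $X\cap Y=\emptyset$ and every edge having one endpoint in $X$ and one in $Y$), the $q$th color compatibility matrix $M$ has rows indexed by all maps $x:X\to[q]$ and columns indexed by all maps $y:Y\to[q]$, with $M[x,y]=1$ if $x(u)\neq y(v)$ for every edge $uv\in E$ with $u\in X$, $v\in Y$, and $M[x,y]=0$ otherwise. $\mathbb{F}_p$ is the field with $p$ elements. -}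

module Defs where

open import Data.Nat using (ℕ; zero; suc; _+_; _*_; _≤_)
open import Data.Nat.Divisibility using (_∣_)
open import Data.Fin using (Fin; zero; suc; _≟_)
open import Data.Product using (_×_; _,_; Σ)
open import Data.Bool using (Bool; true; false; not; if_then_else_)
open import Data.List using (List; filter; length)
open import Relation.Nullary using (⌊_⌋)
open import Relation.Binary.PropositionalEquality using (_≡_)

∑ : (k : ℕ) → (Fin k → ℕ) → ℕ
∑ zero    f = 0
∑ (suc k) f = f zero + ∑ k (λ i → f (suc i))

allB : {A : Set} → (A → Bool) → List A → Bool
allB f List.[] = true
allB f (a List.∷ as) = if f a then allB f as else false

-- A bipartite graph with parts X = Fin m, Y = Fin n is given by its edge
-- list E : List (Fin m × Fin n) (required duplicate-free in the statement);
-- |E| = length E.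

compatible : {m n q : ℕ} → List (Fin m × Fin n) →
             (Fin m → Fin q) → (Fin n → Fin q) → Bool
compatible E x y = allB (λ e → not ⌊ x (Data.Product.proj₁ e) ≟ y (Data.Product.proj₂ e) ⌋) E

colorMatrix : {m n : ℕ} (q : ℕ) → List (Fin m × Fin n) →
              (Fin m → Fin q) → (Fin n → Fin q) → ℕ
colorMatrix q E x y = if compatible E x y then 1 else 0

-- Linear independence over 𝔽_p of the rows  rows 0 , … , rows (k-1)
-- of a matrix M (with entries given by natural-number representatives):
-- every 𝔽_p-linear combination (coefficients represented in ℕ) that vanishes
-- mod p in every column has all coefficients ≡ 0 mod p.
RowsIndependent : {R C : Set} (p : ℕ) (M : R → C → ℕ) {k : ℕ} → (Fin k → R) → Set
RowsIndependent {R} {C} p M {k} rows =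
  (c : Fin k → ℕ) →
  ((col : C) → p ∣ ∑ k (λ i → c i * M (rows i) col)) →
  (i : Fin k) → p ∣ c i

RankAtMost : {R C : Set} (p : ℕ) (M : R → C → ℕ) (r : ℕ) → Set
RankAtMost {R} p M r = (k : ℕ) (rows : Fin k → R) → RowsIndependent p M rows → k ≤ r

RankAtLeast : {R C : Set} (p : ℕ) (M : R → C → ℕ) (r : ℕ) → Set
RankAtLeast {R} p M r = Σ (Fin r → R) (λ rows → RowsIndependent p M rows)

RankEq : {R C : Set} (p : ℕ) (M : R → C → ℕ) (r : ℕ) → Set
RankEq p M r = RankAtMost p M r × RankAtLeast p M r

degX : {m n : ℕ} → List (Fin m × Fin n) → Fin m → ℕ
degX E u = length (filter (λ e → Data.Product.proj₁ e ≟ u) E)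

degY : {m n : ℕ} → List (Fin m × Fin n) → Fin n → ℕ
degY E v = length (filter (λ e → Data.Product.proj₂ e ≟ v) E)

IsPerfectMatching : {m n : ℕ} → List (Fin m × Fin n) → Set
IsPerfectMatching E = ((u : _) → degX E u ≡ 1) × ((v : _) → degY E v ≡ 1)

-- "p divides q - 1" (as integers): q ≥ 1 and p ∣ q ∸ 1.
-- (For q = 0, q - 1 = -1 is not divisible by a prime.)
DividesPred : ℕ → ℕ → Set
DividesPred p q = (1 ≤ q) × (p ∣ Data.Nat._∸_ q 1)

-- The compatibility matrix is the entrywise product, over the edges uv, of the matrices
-- (x, y) ↦ (J − I)[x u, y v], where J − I is the q × q matrix with zeros on the diagonal
-- and ones elsewhere. Over 𝔽_p, J − I factors as a product A B with q inner columns, and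
-- with q − 1 inner columns when p ∣ q − 1; inner dimensions multiply under entrywise
-- products, and a factorization through K columns bounds the rank by K.
-- When E is a perfect matching, the colourings that vary independently on the edges exhibit
-- the Kronecker power of J − I inside the matrix. So a minor of J − I with a right inverse
-- over 𝔽_p, of size q − 1 when p ∣ q − 1 and of size q otherwise, yields one of size
-- (q − 1)^|E| resp. q^|E| in the matrix, and a right-invertible minor bounds the rank from below.

module Submission where

open import Defs
open import Algebra.Bundles using (CommutativeSemiring)
import Algebra.Properties.CommutativeSemigroup as CommutativeSemigroupProperties
import Algebra.Properties.Semiring.Sum as SemiringSum
open import Algebra.Structures using (IsCommutativeMonoid)
open import Algebra.Structures.Biased using (isCommutativeSemiringˡ)
open import Data.Bool using (if_then_else_)
open import Data.Fin using (Fin; zero; suc; _≟_; punchIn; combine; quotient; remainder; _↑ˡ_; _↑ʳ_)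
open import Data.Fin.Properties using (punchInᵢ≢i; remQuot-combine; combine-remQuot; all?; ¬∀⟶∃¬)
open import Data.List using (List; []; _∷_; length; filter; map)
open import Data.List.Relation.Unary.All using (All; []; _∷_; zipWith)
open import Data.List.Relation.Unary.All.Properties using (map⁻)
open import Data.List.Relation.Unary.AllPairs using ([]; _∷_)
open import Data.List.Relation.Unary.Unique.Propositional using (Unique)
open import Data.Nat
  using (ℕ; zero; suc; pred; _+_; _*_; _∸_; _^_; _≤_; _<_; _≤?_; z≤n; s≤s; s≤s⁻¹; NonZero)
open import Data.Nat.Coprimality using (prime⇒coprime; coprime-Bézout)
open import Data.Nat.Divisibility using (_∣_; m%n≡0⇒n∣m; n∣m⇒m%n≡0; m∣m*n; n∣m*n; ∣1⇒≡1)
open import Data.Nat.DivMod using (_%_; %-distribˡ-+; %-distribˡ-*; m*n%n≡0; m%n%n≡m%n; m%n<n)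
open import Data.Nat.GCD using (module Bézout)
open import Data.Nat.Primality using (Prime; prime⇒nonZero; euclidsLemma; ¬prime[1])
open import Data.Nat.Properties as ℕ
  using (m<n⇒m<1+n; ≰⇒>; +-identityʳ; ≤-refl; ≤-trans; ≤-reflexive; n≤1+n; n≤0⇒n≡0; suc-pred)
open import Data.Nat.Tactic.RingSolver using (solve-∀)
open import Data.Product using (_×_; _,_; proj₁; proj₂; ∃; Σ)
open import Data.Sum using (inj₁; inj₂)
open import Data.Vec.Functional using (insertAt; updateAt)
open import Data.Vec.Functional.Properties
  using (insertAt-lookup; insertAt-punchIn; updateAt-updates; updateAt-minimal)
open import Function using (_∘_; id; const)
open import Level using (0ℓ)
open import Relation.Binary using (IsEquivalence; Decidable)
open import Relation.Binary.PropositionalEquality using (_≡_; _≢_; refl; sym; trans; cong; cong₂; subst)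
import Relation.Binary.Reasoning.Setoid as SetoidReasoning
open import Relation.Nullary using (¬_; does; yes; no; contradiction)
open import Relation.Nullary.Decidable as Dec using (dec-true; dec-false)

δ : ∀ {k} → Fin k → Fin k → ℕ
δ i j = if does (i ≟ j) then 1 else 0

-- δᶜ is the matrix J − I, the compatibility matrix of a single edge.
δᶜ : ∀ {k} → Fin k → Fin k → ℕ
δᶜ i j = if does (i ≟ j) then 0 else 1

module _ {k} {i j : Fin k} where

  δ-≡ : i ≡ j → δ i j ≡ 1
  δ-≡ i≡j rewrite dec-true (i ≟ j) i≡j = refl

  δ-≢ : i ≢ j → δ i j ≡ 0
  δ-≢ i≢j rewrite dec-false (i ≟ j) i≢j = refl

  δᶜ-≡ : i ≡ j → δᶜ i j ≡ 0
  δᶜ-≡ i≡j rewrite dec-true (i ≟ j) i≡j = refl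

  δᶜ-≢ : i ≢ j → δᶜ i j ≡ 1
  δᶜ-≢ i≢j rewrite dec-false (i ≟ j) i≢j = refl

δ-remQuot : ∀ {m n} (τ σ : Fin (m * n)) →
  δ τ σ ≡ δ (quotient {m} n τ) (quotient {m} n σ) * δ (remainder {m} n τ) (remainder {m} n σ)
δ-remQuot {m} {n} τ σ with τ ≟ σ | quotient {m} n τ ≟ quotient {m} n σ
... | yes refl | yes _    = sym (cong (_+ 0) (δ-≡ {i = remainder {m} n τ} refl))
... | yes refl | no q≢q   = contradiction refl q≢q
... | no  _    | no _     = refl
... | no  τ≢σ  | yes q≡q′ = sym (cong (_+ 0) (δ-≢ r≢r′))
  where
  r≢r′ : remainder {m} n τ ≢ remainder {m} n σ
  r≢r′ r≡r′ = τ≢σ (trans (sym (combine-remQuot {m} n τ))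
                  (trans (cong₂ combine q≡q′ r≡r′) (combine-remQuot {m} n σ)))

colorMatrix-∷ : ∀ {m n} q (u : Fin m) (v : Fin n) E x y →
  colorMatrix q ((u , v) ∷ E) x y ≡ δᶜ (x u) (y v) * colorMatrix q E x y
colorMatrix-∷ q u v E x y with x u ≟ y v
... | yes _ = refl
... | no  _ = sym (+-identityʳ _)

colorMatrix-agree : ∀ {m n} q {x x′ : Fin m → Fin q} {y y′ : Fin n → Fin q} {E} →
  All (λ e → x (proj₁ e) ≡ x′ (proj₁ e) × y (proj₂ e) ≡ y′ (proj₂ e)) E →
  colorMatrix q E x y ≡ colorMatrix q E x′ y′
colorMatrix-agree q [] = refl
colorMatrix-agree q {x} {x′} {y} {y′} {(u , v) ∷ E} ((xu≡x′u , yv≡y′v) ∷ agree) =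
  trans (colorMatrix-∷ q u v E x y)
    (trans (cong₂ _*_ (cong₂ δᶜ xu≡x′u yv≡y′v) (colorMatrix-agree q agree))
      (sym (colorMatrix-∷ q u v E x′ y′)))

colorMatrix-updateAt : ∀ {m n} q {u : Fin m} {v : Fin n} {E} →
  All (u ≢_) (map proj₁ E) → All (v ≢_) (map proj₂ E) → ∀ a b x y →
  colorMatrix q ((u , v) ∷ E) (updateAt x u (const a)) (updateAt y v (const b))
    ≡ δᶜ a b * colorMatrix q E x y
colorMatrix-updateAt q {u} {v} {E} u∉E v∉E a b x y =
  trans (colorMatrix-∷ q u v E _ _)
    (cong₂ _*_ (cong₂ δᶜ (updateAt-updates u x) (updateAt-updates v y))
      (colorMatrix-agree q (zipWith untouched (map⁻ u∉E , map⁻ v∉E))))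
  where
  untouched : ∀ {e} → u ≢ proj₁ e × v ≢ proj₂ e →
    updateAt x u (const a) (proj₁ e) ≡ x (proj₁ e) × updateAt y v (const b) (proj₂ e) ≡ y (proj₂ e)
  untouched (u≢ , v≢) = updateAt-minimal _ u x (u≢ ∘ sym) , updateAt-minimal _ v y (v≢ ∘ sym)

module _ {A : Set} {k} (f : A → Fin k) where

  degree : List A → Fin k → ℕ
  degree E w = length (filter (λ e → f e ≟ w) E)

  degree-∷ : ∀ e E w → degree E w ≤ degree (e ∷ E) w
  degree-∷ e E w with f e ≟ w
  ... | yes _ = n≤1+n _
  ... | no  _ = ≤-refl

  degree-∷-self : ∀ e E → degree (e ∷ E) (f e) ≡ suc (degree E (f e))
  degree-∷-self e E with f e ≟ f e
  ... | yes _    = refl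
  ... | no  fe≢fe = contradiction refl fe≢fe

  degree≡0⇒fresh : ∀ E w → degree E w ≡ 0 → All (w ≢_) (map f E)
  degree≡0⇒fresh []      w _     = []
  degree≡0⇒fresh (e ∷ E) w deg≡0 with f e ≟ w
  ... | no fe≢w = (fe≢w ∘ sym) ∷ degree≡0⇒fresh E w deg≡0

  degree≤1⇒unique : ∀ E → (∀ w → degree E w ≤ 1) → Unique (map f E)
  degree≤1⇒unique []      _     = []
  degree≤1⇒unique (e ∷ E) deg≤1 =
    fresh ∷ degree≤1⇒unique E (λ w → ≤-trans (degree-∷ e E w) (deg≤1 w))
    where
    fresh : All (f e ≢_) (map f E)
    fresh = degree≡0⇒fresh E (f e)
      (n≤0⇒n≡0 (s≤s⁻¹ (subst (_≤ 1) (degree-∷-self e E) (deg≤1 (f e)))))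

Matching : ∀ {m n} → List (Fin m × Fin n) → Set
Matching E = Unique (map proj₁ E) × Unique (map proj₂ E)

-- degX and degY are definitionally degree proj₁ and degree proj₂.
perfectMatching⇒matching : ∀ {m n} {E : List (Fin m × Fin n)} → IsPerfectMatching E → Matching E
perfectMatching⇒matching {E = E} (degX≡1 , degY≡1) =
  degree≤1⇒unique proj₁ E (≤-reflexive ∘ degX≡1) ,
  degree≤1⇒unique proj₂ E (≤-reflexive ∘ degY≡1)

-- ℤ/pℤ, presented on ℕ with equality modulo p; -1# = p − 1 stands in for negation.
module Modulo (p : ℕ) .{{_ : NonZero p}} where

  infix 4 _≈_ _≉_

  private variable
    R C R′ C′ : Set

  record _≈_ (a b : ℕ) : Set where
    constructor mod-p
    field %-≡ : a % p ≡ b % p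

  _≉_ : ℕ → ℕ → Set
  a ≉ b = ¬ a ≈ b

  ≈-isEquivalence : IsEquivalence _≈_
  ≈-isEquivalence = record
    { refl  = mod-p refl
    ; sym   = λ (mod-p e) → mod-p (sym e)
    ; trans = λ (mod-p e) (mod-p f) → mod-p (trans e f)
    }

  ≡⇒≈ : ∀ {a b} → a ≡ b → a ≈ b
  ≡⇒≈ = mod-p ∘ cong (_% p)

  _≈?_ : Decidable _≈_
  a ≈? b = Dec.map′ mod-p _≈_.%-≡ (a % p ℕ.≟ b % p)

  +-cong : ∀ {a b c d} → a ≈ b → c ≈ d → a + c ≈ b + d
  +-cong {a} {b} {c} {d} (mod-p a≈b) (mod-p c≈d) = mod-p
    (trans (%-distribˡ-+ a c p)
      (trans (cong₂ (λ x y → (x + y) % p) a≈b c≈d) (sym (%-distribˡ-+ b d p))))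

  *-cong : ∀ {a b c d} → a ≈ b → c ≈ d → a * c ≈ b * d
  *-cong {a} {b} {c} {d} (mod-p a≈b) (mod-p c≈d) = mod-p
    (trans (%-distribˡ-* a c p)
      (trans (cong₂ (λ x y → (x * y) % p) a≈b c≈d) (sym (%-distribˡ-* b d p))))

  private
    coarsen : ∀ {_∙_ ε} → IsCommutativeMonoid _≡_ _∙_ ε →
              (∀ {a b c d} → a ≈ b → c ≈ d → (a ∙ c) ≈ (b ∙ d)) →
              IsCommutativeMonoid _≈_ _∙_ ε
    coarsen M ∙≈-cong = record
      { isMonoid = record
        { isSemigroup = record
          { isMagma = record { isEquivalence = ≈-isEquivalence ; ∙-cong = ∙≈-cong }
          ; assoc   = λ x y z → ≡⇒≈ (assoc x y z)
          }
        ; identity = ≡⇒≈ ∘ identityˡ , ≡⇒≈ ∘ identityʳ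
        }
      ; comm = λ x y → ≡⇒≈ (comm x y)
      }
      where open IsCommutativeMonoid M using (assoc; identityˡ; identityʳ; comm)

  ℕ/p : CommutativeSemiring 0ℓ 0ℓ
  ℕ/p = record
    { _≈_ = _≈_
    ; _+_ = _+_
    ; _*_ = _*_
    ; 0#  = 0
    ; 1#  = 1
    ; isCommutativeSemiring = isCommutativeSemiringˡ record
      { +-isCommutativeMonoid = coarsen ℕ.+-0-isCommutativeMonoid +-cong
      ; *-isCommutativeMonoid = coarsen ℕ.*-1-isCommutativeMonoid *-cong
      ; distribʳ = λ x y z → ≡⇒≈ (ℕ.*-distribʳ-+ x y z)
      ; zeroˡ    = λ x → ≡⇒≈ refl
      }
    }

  open CommutativeSemiring ℕ/p public
    using ( setoid; +-congˡ; +-congʳ; *-congˡ; *-congʳ; zeroʳ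
          ; +-commutativeSemigroup; *-commutativeSemigroup)
    renaming (refl to ≈-refl; sym to ≈-sym; trans to ≈-trans)
  open SemiringSum (CommutativeSemiring.semiring ℕ/p) public
    using ( sum; sum-cong-≋; sum-cong-≗; sum-replicate-zero; sum-remove
          ; ∑-distrib-+; ∑-comm; *-distribˡ-sum; *-distribʳ-sum)
  open SetoidReasoning setoid
  module + = CommutativeSemigroupProperties +-commutativeSemigroup
  module * = CommutativeSemigroupProperties *-commutativeSemigroup

  ∣⇒≈0 : ∀ {a} → p ∣ a → a ≈ 0
  ∣⇒≈0 {a} p∣a = mod-p (trans (n∣m⇒m%n≡0 a p p∣a) (sym (m*n%n≡0 0 p)))

  ≈0⇒∣ : ∀ {a} → a ≈ 0 → p ∣ a
  ≈0⇒∣ {a} (mod-p a≈0) = m%n≡0⇒n∣m a p (trans a≈0 (m*n%n≡0 0 p))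

  -1# : ℕ
  -1# = pred p

  -1#-inverse : ∀ x → x + -1# * x ≈ 0
  -1#-inverse x = begin
    x + -1# * x ≡⟨ cong (_* x) (suc-pred p) ⟩
    p * x       ≈⟨ ∣⇒≈0 (m∣m*n x) ⟩
    0           ∎

  x+y≈0⇒-1#*x≈y : ∀ {x y} → x + y ≈ 0 → -1# * x ≈ y
  x+y≈0⇒-1#*x≈y {x} {y} x+y≈0 = begin
    -1# * x             ≡⟨ +-identityʳ _ ⟨
    -1# * x + 0         ≈⟨ +-congˡ x+y≈0 ⟨
    -1# * x + (x + y)   ≈⟨ +.x∙yz≈yx∙z _ x y ⟩
    (x + -1# * x) + y   ≈⟨ +-congʳ (-1#-inverse x) ⟩
    y                   ∎

  1≉0 : Prime p → 1 ≉ 0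
  1≉0 p-prime 1≈0 = ¬prime[1] (subst Prime (∣1⇒≡1 (≈0⇒∣ 1≈0)) p-prime)

  *-≉0 : Prime p → ∀ {a b} → a ≉ 0 → b ≉ 0 → a * b ≉ 0
  *-≉0 p-prime {a} {b} a≉0 b≉0 ab≈0 with euclidsLemma a b p-prime (≈0⇒∣ ab≈0)
  ... | inj₁ p∣a = a≉0 (∣⇒≈0 p∣a)
  ... | inj₂ p∣b = b≉0 (∣⇒≈0 p∣b)

  ≉0⇒invertible : Prime p → ∀ {a} → a ≉ 0 → ∃ λ l → l * a ≈ 1
  ≉0⇒invertible p-prime {a} a≉0 with a % p in a%p≡r
  ... | zero  = contradiction (mod-p (trans a%p≡r (sym (m*n%n≡0 0 p)))) a≉0
  ... | suc r = invert (coprime-Bézout (prime⇒coprime p-prime (subst (_< p) a%p≡r (m%n<n a p))))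
    where
    a≈r : a ≈ suc r
    a≈r = mod-p (trans (sym (m%n%n≡m%n a p)) (cong (_% p) a%p≡r))

    invert : Bézout.Identity 1 p (suc r) → ∃ λ l → l * a ≈ 1
    invert (Bézout.+- x y 1+yr≡xp) = -1# * y , (begin
      -1# * y * a       ≈⟨ *-congˡ { -1# * y} a≈r ⟩
      -1# * y * suc r   ≡⟨ ℕ.*-assoc -1# y (suc r) ⟩
      -1# * (y * suc r) ≈⟨ x+y≈0⇒-1#*x≈y yr+1≈0 ⟩
      1                 ∎)
      where
      yr+1≈0 : y * suc r + 1 ≈ 0
      yr+1≈0 = begin
        y * suc r + 1 ≡⟨ ℕ.+-comm _ 1 ⟩
        1 + y * suc r ≡⟨ 1+yr≡xp ⟩
        x * p         ≈⟨ ∣⇒≈0 (n∣m*n x) ⟩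
        0             ∎
    invert (Bézout.-+ x y 1+xp≡yr) = y , (begin
      y * a     ≈⟨ *-congˡ {y} a≈r ⟩
      y * suc r ≡⟨ 1+xp≡yr ⟨
      1 + x * p ≈⟨ +-congˡ (∣⇒≈0 (n∣m*n x)) ⟩
      1         ∎)

  ∑≡sum : ∀ k (f : Fin k → ℕ) → ∑ k f ≡ sum f
  ∑≡sum zero    f = refl
  ∑≡sum (suc k) f = cong (f zero +_) (∑≡sum k (f ∘ suc))

  sum-≈0 : ∀ {k} {f : Fin k → ℕ} → (∀ i → f i ≈ 0) → sum f ≈ 0
  sum-≈0 {k} f≈0 = ≈-trans (sum-cong-≋ f≈0) (sum-replicate-zero k)

  sum-ones : ∀ k → sum {k} (λ _ → 1) ≡ k
  sum-ones zero    = refl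
  sum-ones (suc k) = cong suc (sum-ones k)

  sum-δ : ∀ {k} (v : Fin k → ℕ) j → sum (λ i → v i * δ i j) ≈ v j
  sum-δ {suc k} v j = begin
    sum (λ i → v i * δ i j)
      ≈⟨ sum-remove {i = j} (λ i → v i * δ i j) ⟩
    v j * δ j j + sum (λ i → v (punchIn j i) * δ (punchIn j i) j)
      ≈⟨ +-cong (≡⇒≈ diagonal) (sum-≈0 (≡⇒≈ ∘ offDiagonal)) ⟩
    v j + 0
      ≡⟨ +-identityʳ _ ⟩
    v j ∎
    where
    diagonal : v j * δ j j ≡ v j
    diagonal = trans (cong (v j *_) (δ-≡ {i = j} refl)) (ℕ.*-identityʳ _)
    offDiagonal : ∀ i → v (punchIn j i) * δ (punchIn j i) j ≡ 0
    offDiagonal i =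
      trans (cong (v (punchIn j i) *_) (δ-≢ (punchInᵢ≢i j i))) (ℕ.*-zeroʳ (v (punchIn j i)))

  sum-δᶜ : ∀ {k} (i : Fin (suc k)) → sum (δᶜ i) ≈ k
  sum-δᶜ {k} i = begin
    sum (δᶜ i)
      ≈⟨ sum-remove {i = i} (δᶜ i) ⟩
    δᶜ i i + sum (λ j → δᶜ i (punchIn i j))
      ≡⟨ cong₂ _+_ (δᶜ-≡ {i = i} refl) (sum-cong-≗ (λ j → δᶜ-≢ (punchInᵢ≢i i j ∘ sym))) ⟩
    sum {k} (λ _ → 1)
      ≡⟨ sum-ones k ⟩
    k ∎

  sum-↑ : ∀ m {n} (f : Fin (m + n) → ℕ) →
    sum f ≈ sum (λ i → f (i ↑ˡ n)) + sum (λ j → f (m ↑ʳ j))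
  sum-↑ zero        f = ≈-refl
  sum-↑ (suc m) {n} f = begin
    f zero + sum (f ∘ suc)
      ≈⟨ +-congˡ {f zero} (sum-↑ m (f ∘ suc)) ⟩
    f zero + (sum {m} (f ∘ suc ∘ (_↑ˡ n)) + sum {n} (f ∘ suc ∘ (m ↑ʳ_)))
      ≡⟨ ℕ.+-assoc (f zero) _ _ ⟨
    f zero + sum {m} (f ∘ suc ∘ (_↑ˡ n)) + sum {n} (f ∘ suc ∘ (m ↑ʳ_)) ∎

  sum-combine : ∀ m {n} (f : Fin (m * n) → ℕ) →
    sum f ≈ sum (λ i → sum (λ j → f (combine {m} {n} i j)))
  sum-combine zero        f = ≈-refl
  sum-combine (suc m) {n} f =
    ≈-trans (sum-↑ n f)
      (+-congˡ {sum {n} (λ j → f (j ↑ˡ m * n))} (sum-combine m (λ τ → f (n ↑ʳ τ))))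

  sum-remQuot : ∀ m {n} (f : Fin m → ℕ) (g : Fin n → ℕ) →
    sum (λ τ → f (quotient {m} n τ) * g (remainder {m} n τ)) ≈ sum f * sum g
  sum-remQuot m {n} f g = begin
    sum (λ τ → f (quotient {m} n τ) * g (remainder {m} n τ))
      ≈⟨ sum-combine m (λ τ → f (quotient {m} n τ) * g (remainder {m} n τ)) ⟩
    sum (λ i → sum (λ j → f (quotient {m} n (combine i j)) * g (remainder {m} n (combine {m} {n} i j))))
      ≡⟨ sum-cong-≗ {m} (λ i → sum-cong-≗ {n} (λ j →
           cong (λ ij → f (proj₁ ij) * g (proj₂ ij)) (remQuot-combine i j))) ⟩
    sum (λ i → sum (λ j → f i * g j))
      ≈⟨ sum-cong-≋ (λ i → *-distribˡ-sum (f i) g) ⟨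
    sum (λ i → f i * sum g)
      ≈⟨ *-distribʳ-sum (sum g) f ⟨
    sum f * sum g                                              ∎

  sum-reassoc : ∀ {k l} (c : Fin k → ℕ) (A : Fin k → Fin l → ℕ) (b : Fin l → ℕ) →
    sum (λ i → c i * sum (λ t → A i t * b t)) ≈ sum (λ t → sum (λ i → c i * A i t) * b t)
  sum-reassoc c A b = begin
    sum (λ i → c i * sum (λ t → A i t * b t))
      ≈⟨ sum-cong-≋ (λ i → *-distribˡ-sum (c i) (λ t → A i t * b t)) ⟩
    sum (λ i → sum (λ t → c i * (A i t * b t)))
      ≈⟨ ∑-comm (λ i t → c i * (A i t * b t)) ⟩
    sum (λ t → sum (λ i → c i * (A i t * b t)))
      ≡⟨ sum-cong-≗ (λ t → sum-cong-≗ (λ i → ℕ.*-assoc (c i) (A i t) (b t))) ⟨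
    sum (λ t → sum (λ i → c i * A i t * b t))
      ≈⟨ sum-cong-≋ (λ t → *-distribʳ-sum (b t) (λ i → c i * A i t)) ⟨
    sum (λ t → sum (λ i → c i * A i t) * b t) ∎

  -- Linear dependence and rank

  record Dependency {k} (f : Fin k → C → ℕ) : Set where
    field
      coeff    : Fin k → ℕ
      vanishes : ∀ y → sum (λ i → coeff i * f i y) ≈ 0
      nonzero  : Σ (Fin k) λ i → coeff i ≉ 0

  dependency-zeroColumn : ∀ {k r} {f : Fin k → Fin (suc r) → ℕ} →
    (∀ i → f i zero ≈ 0) → Dependency (λ i j → f i (suc j)) → Dependency f
  dependency-zeroColumn {f = f} column≈0 D =
    record { coeff = coeff ; vanishes = vanishes′ ; nonzero = nonzero }
    where
    open Dependency D
    vanishes′ : ∀ j → sum (λ i → coeff i * f i j) ≈ 0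
    vanishes′ zero    = sum-≈0 (λ i → ≈-trans (*-congˡ {coeff i} (column≈0 i)) (zeroʳ (coeff i)))
    vanishes′ (suc j) = vanishes j

  eliminate : ∀ {k r} → Fin (suc k) → (Fin (suc k) → Fin (suc r) → ℕ) →
              Fin k → Fin (suc r) → ℕ
  eliminate i₀ f i j = f i₀ zero * f (punchIn i₀ i) j + -1# * (f (punchIn i₀ i) zero * f i₀ j)

  eliminate-zeroColumn : ∀ {k r} i₀ (f : Fin (suc k) → Fin (suc r) → ℕ) i →
    eliminate i₀ f i zero ≈ 0
  eliminate-zeroColumn i₀ f i = begin
    f i₀ zero * f (punchIn i₀ i) zero + -1# * (f (punchIn i₀ i) zero * f i₀ zero)
      ≡⟨ cong (λ z → f i₀ zero * f (punchIn i₀ i) zero + -1# * z)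
              (ℕ.*-comm (f (punchIn i₀ i) zero) _) ⟩
    f i₀ zero * f (punchIn i₀ i) zero + -1# * (f i₀ zero * f (punchIn i₀ i) zero)
      ≈⟨ -1#-inverse _ ⟩
    0 ∎

  dependency-eliminate : Prime p → ∀ {k r} i₀ {f : Fin (suc k) → Fin (suc r) → ℕ} →
    f i₀ zero ≉ 0 → Dependency (eliminate i₀ f) → Dependency f
  dependency-eliminate p-prime {k} {r} i₀ {f} pivot≉0 D = record
    { coeff    = c
    ; vanishes = vanishes′
    ; nonzero  = punchIn i₀ (proj₁ nonzero) , λ c≈0 →
        *-≉0 p-prime (proj₂ nonzero) pivot≉0 (subst (_≈ 0) (insertAt-punchIn _ i₀ _ _) c≈0)
    }
    where
    open Dependency D renaming (coeff to d)
    φ : ℕ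
    φ = f i₀ zero
    g : Fin k → Fin (suc r) → ℕ
    g = f ∘ punchIn i₀
    S : ℕ
    S = sum (λ i → d i * g i zero)
    c : Fin (suc k) → ℕ
    c = insertAt (λ i → d i * φ) i₀ (-1# * S)

    expand : ∀ d φ a b m z → d * φ * a + m * z * (d * b) ≡ d * (φ * a + m * (b * z))
    expand = solve-∀

    vanishes′ : ∀ j → sum (λ i → c i * f i j) ≈ 0
    vanishes′ j = begin
      sum (λ i → c i * f i j)
        ≈⟨ sum-remove {i = i₀} (λ i → c i * f i j) ⟩
      c i₀ * f i₀ j + sum (λ i → c (punchIn i₀ i) * g i j)
        ≡⟨ cong₂ _+_ (cong (_* f i₀ j) (insertAt-lookup _ i₀ _))
                     (sum-cong-≗ (λ i → cong (_* g i j) (insertAt-punchIn _ i₀ _ i))) ⟩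
      -1# * S * f i₀ j + sum (λ i → d i * φ * g i j)
        ≈⟨ +-congʳ {sum (λ i → d i * φ * g i j)} (*.xy∙z≈xz∙y -1# S (f i₀ j)) ⟩
      -1# * f i₀ j * S + sum (λ i → d i * φ * g i j)
        ≡⟨ ℕ.+-comm (-1# * f i₀ j * S) _ ⟩
      sum (λ i → d i * φ * g i j) + -1# * f i₀ j * S
        ≈⟨ +-congˡ {sum (λ i → d i * φ * g i j)}
             (*-distribˡ-sum (-1# * f i₀ j) (λ i → d i * g i zero)) ⟩
      sum (λ i → d i * φ * g i j) + sum (λ i → -1# * f i₀ j * (d i * g i zero))
        ≈⟨ ∑-distrib-+ (λ i → d i * φ * g i j) (λ i → -1# * f i₀ j * (d i * g i zero)) ⟨
      sum (λ i → d i * φ * g i j + -1# * f i₀ j * (d i * g i zero))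
        ≡⟨ sum-cong-≗ (λ i → expand (d i) φ (g i j) (g i zero) -1# (f i₀ j)) ⟩
      sum (λ i → d i * eliminate i₀ f i j)
        ≈⟨ vanishes j ⟩
      0 ∎

  dependency : Prime p → ∀ {k r} → r < k → (f : Fin k → Fin r → ℕ) → Dependency f
  dependency p-prime {suc k} {zero} _ f =
    record { coeff = λ _ → 1 ; vanishes = λ () ; nonzero = zero , 1≉0 p-prime }
  dependency p-prime {suc k} {suc r} (s≤s r<k) f with all? (λ i → f i zero ≈? 0)
  ... | yes column≈0 = dependency-zeroColumn column≈0 (dependency p-prime (m<n⇒m<1+n r<k) _)
  ... | no ¬column≈0 with ¬∀⟶∃¬ (suc k) _ (λ i → f i zero ≈? 0) ¬column≈0
  ...   | i₀ , pivot≉0 = dependency-eliminate p-prime i₀ pivot≉0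
                           (dependency-zeroColumn (eliminate-zeroColumn i₀ f) (dependency p-prime r<k _))

  independent⇒¬dependency : ∀ {M : R → C → ℕ} {k} {rows : Fin k → R} →
    RowsIndependent p M rows → ¬ Dependency (M ∘ rows)
  independent⇒¬dependency {M = M} {k} {rows} independent D =
    proj₂ nonzero (∣⇒≈0 (independent coeff vanishes′ (proj₁ nonzero)))
    where
    open Dependency D
    vanishes′ : ∀ y → p ∣ ∑ k (λ i → coeff i * M (rows i) y)
    vanishes′ y = ≈0⇒∣ (subst (_≈ 0) (sym (∑≡sum k _)) (vanishes y))

  record Factorization (M : R → C → ℕ) (K : ℕ) : Set where
    field
      left       : R → Fin K → ℕ
      right      : Fin K → C → ℕ
      factorizes : ∀ x y → M x y ≈ sum (λ t → left x t * right t y)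

  dependency-factorization : ∀ {M : R → C → ℕ} {K k} (F : Factorization M K) {rows : Fin k → R} →
    Dependency (Factorization.left F ∘ rows) → Dependency (M ∘ rows)
  dependency-factorization {M = M} F {rows} D =
    record { coeff = coeff ; vanishes = vanishes′ ; nonzero = nonzero }
    where
    open Factorization F
    open Dependency D
    vanishes′ : ∀ y → sum (λ i → coeff i * M (rows i) y) ≈ 0
    vanishes′ y = begin
      sum (λ i → coeff i * M (rows i) y)
        ≈⟨ sum-cong-≋ (λ i → *-congˡ {coeff i} (factorizes (rows i) y)) ⟩
      sum (λ i → coeff i * sum (λ t → left (rows i) t * right t y))
        ≈⟨ sum-reassoc coeff (left ∘ rows) (λ t → right t y) ⟩
      sum (λ t → sum (λ i → coeff i * left (rows i) t) * right t y)
        ≈⟨ sum-≈0 (λ t → *-congʳ {right t y} (vanishes t)) ⟩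
      0 ∎

  factorization⇒rankAtMost : Prime p → ∀ {M : R → C → ℕ} {K} → Factorization M K → RankAtMost p M K
  factorization⇒rankAtMost p-prime {M = M} {K} F k rows independent with k ≤? K
  ... | yes k≤K = k≤K
  ... | no  k≰K = contradiction
    (dependency-factorization F (dependency p-prime (≰⇒> k≰K) (Factorization.left F ∘ rows)))
    (independent⇒¬dependency {M = M} {rows = rows} independent)

  factorization-∘ : ∀ {M : R → C → ℕ} {M′ : R′ → C′ → ℕ} {K}
    (f : R′ → R) (g : C′ → C) →
    (∀ x y → M′ x y ≡ M (f x) (g y)) → Factorization M K → Factorization M′ K
  factorization-∘ f g pullback F = record
    { left       = left ∘ f
    ; right      = λ t → right t ∘ g
    ; factorizes = λ x y → ≈-trans (≡⇒≈ (pullback x y)) (factorizes (f x) (g y))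
    }
    where open Factorization F

  _⊙_ :  (R → C → ℕ) → (R → C → ℕ) → R → C → ℕ
  (M ⊙ N) x y = M x y * N x y

  factorization-⊙ : ∀ {M N : R → C → ℕ} {K L} →
    Factorization M K → Factorization N L → Factorization (M ⊙ N) (K * L)
  factorization-⊙ {M = M} {N} {K} {L} F G = record
    { left       = λ x τ → F.left x (t₁ τ) * G.left x (t₂ τ)
    ; right      = λ τ y → F.right (t₁ τ) y * G.right (t₂ τ) y
    ; factorizes = λ x y → begin
        M x y * N x y
          ≈⟨ *-cong (F.factorizes x y) (G.factorizes x y) ⟩
        sum (λ t → F.left x t * F.right t y) * sum (λ t → G.left x t * G.right t y)
          ≈⟨ sum-remQuot K (λ t → F.left x t * F.right t y) (λ t → G.left x t * G.right t y) ⟨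
        sum (λ τ → F.left x (t₁ τ) * F.right (t₁ τ) y * (G.left x (t₂ τ) * G.right (t₂ τ) y))
          ≈⟨ sum-cong-≋ (λ τ → *.interchange (F.left x (t₁ τ)) _ _ _) ⟩
        sum (λ τ → F.left x (t₁ τ) * G.left x (t₂ τ) * (F.right (t₁ τ) y * G.right (t₂ τ) y))
          ∎
    }
    where
    module F = Factorization F
    module G = Factorization G
    t₁ : Fin (K * L) → Fin K
    t₁ = quotient L
    t₂ : Fin (K * L) → Fin L
    t₂ = remainder {K} L

  record RightInvertibleMinor (M : R → C → ℕ) (K : ℕ) : Set where
    field
      N              : ℕ
      rows           : Fin K → R
      cols           : Fin N → C
      inverse        : Fin N → Fin K → ℕ
      isRightInverse : ∀ i i′ → sum (λ j → M (rows i) (cols j) * inverse j i′) ≈ δ i i′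

  minor-zero : ∀ {M : R → C → ℕ} → RightInvertibleMinor M 0
  minor-zero = record { N = 0 ; rows = λ () ; cols = λ () ; inverse = λ () ; isRightInverse = λ () }

  minor⇒rankAtLeast : ∀ {M : R → C → ℕ} {K} → RightInvertibleMinor M K → RankAtLeast p M K
  minor⇒rankAtLeast {M = M} {K} minor = rows , independent
    where
    open RightInvertibleMinor minor
    independent : RowsIndependent p M rows
    independent c vanishes i′ = ≈0⇒∣ (begin
      c i′
        ≈⟨ sum-δ c i′ ⟨
      sum (λ i → c i * δ i i′)
        ≈⟨ sum-cong-≋ (λ i → *-congˡ {c i} (isRightInverse i i′)) ⟨
      sum (λ i → c i * sum (λ j → M (rows i) (cols j) * inverse j i′))
        ≈⟨ sum-reassoc c (λ i j → M (rows i) (cols j)) (λ j → inverse j i′) ⟩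
      sum (λ j → sum (λ i → c i * M (rows i) (cols j)) * inverse j i′)
        ≈⟨ sum-≈0 (λ j → *-congʳ {inverse j i′}
             (subst (_≈ 0) (∑≡sum K _) (∣⇒≈0 (vanishes (cols j))))) ⟩
      0 ∎)

  minor-∘ : ∀ {M : R → C → ℕ} {M′ : R′ → C′ → ℕ} {K} (f : R′ → R) (g : C′ → C) →
    (∀ x y → M (f x) (g y) ≡ M′ x y) → RightInvertibleMinor M′ K → RightInvertibleMinor M K
  minor-∘ f g pushforward minor = record
    { N              = N
    ; rows           = f ∘ rows
    ; cols           = g ∘ cols
    ; inverse        = inverse
    ; isRightInverse = λ i i′ →
        ≈-trans (≡⇒≈ (sum-cong-≗ (λ j → cong (_* inverse j i′) (pushforward (rows i) (cols j)))))
                (isRightInverse i i′)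
    }
    where open RightInvertibleMinor minor

  _⊗_ :  (R → C → ℕ) → (R′ → C′ → ℕ) → R × R′ → C × C′ → ℕ
  (M ⊗ M′) (x , x′) (y , y′) = M x y * M′ x′ y′

  minor-⊗ : ∀ {M : R → C → ℕ} {M′ : R′ → C′ → ℕ} {K K′} →
    RightInvertibleMinor M K → RightInvertibleMinor M′ K′ → RightInvertibleMinor (M ⊗ M′) (K * K′)
  minor-⊗ {M = M} {M′} {K} {K′} A B = record
    { N              = A.N * B.N
    ; rows           = λ τ → A.rows (i₁ τ) , B.rows (i₂ τ)
    ; cols           = λ σ → A.cols (j₁ σ) , B.cols (j₂ σ)
    ; inverse        = λ σ τ → A.inverse (j₁ σ) (i₁ τ) * B.inverse (j₂ σ) (i₂ τ)
    ; isRightInverse = λ τ τ′ → begin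
        sum (λ σ → M (A.rows (i₁ τ)) (A.cols (j₁ σ)) * M′ (B.rows (i₂ τ)) (B.cols (j₂ σ))
                   * (A.inverse (j₁ σ) (i₁ τ′) * B.inverse (j₂ σ) (i₂ τ′)))
          ≈⟨ sum-cong-≋ (λ σ → *.interchange (M (A.rows (i₁ τ)) (A.cols (j₁ σ))) _ _ _) ⟩
        sum (λ σ → M (A.rows (i₁ τ)) (A.cols (j₁ σ)) * A.inverse (j₁ σ) (i₁ τ′)
                   * (M′ (B.rows (i₂ τ)) (B.cols (j₂ σ)) * B.inverse (j₂ σ) (i₂ τ′)))
          ≈⟨ sum-remQuot A.N (λ j → M (A.rows (i₁ τ)) (A.cols j) * A.inverse j (i₁ τ′))
                              (λ j → M′ (B.rows (i₂ τ)) (B.cols j) * B.inverse j (i₂ τ′)) ⟩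
        sum (λ j → M (A.rows (i₁ τ)) (A.cols j) * A.inverse j (i₁ τ′))
          * sum (λ j → M′ (B.rows (i₂ τ)) (B.cols j) * B.inverse j (i₂ τ′))
          ≈⟨ *-cong (A.isRightInverse (i₁ τ) (i₁ τ′)) (B.isRightInverse (i₂ τ) (i₂ τ′)) ⟩
        δ (i₁ τ) (i₁ τ′) * δ (i₂ τ) (i₂ τ′)
          ≡⟨ δ-remQuot {K} {K′} τ τ′ ⟨
        δ τ τ′ ∎
    }
    where
    module A = RightInvertibleMinor A
    module B = RightInvertibleMinor B
    i₁ : Fin (K * K′) → Fin K
    i₁ = quotient K′
    i₂ : Fin (K * K′) → Fin K′
    i₂ = remainder {K} K′
    j₁ : Fin (A.N * B.N) → Fin A.N
    j₁ = quotient B.N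
    j₂ : Fin (A.N * B.N) → Fin B.N
    j₂ = remainder {A.N} B.N

  -- The matrix J − I

  δᶜ-factorization : ∀ {q} → Factorization (δᶜ {q}) q
  δᶜ-factorization = record { left = δᶜ ; right = δ ; factorizes = λ a b → ≈-sym (sum-δ (δᶜ a) b) }

  -- Every row of J − I sums to s ≡ 0, so column 0 is minus the sum of the other columns.
  δᶜ-factorization-divisible : ∀ {s} → p ∣ s → Factorization (δᶜ {suc s}) s
  δᶜ-factorization-divisible {s} p∣s = record
    { left       = λ a t → δᶜ a (suc t)
    ; right      = right
    ; factorizes = factorizes
    }
    where
    right : Fin s → Fin (suc s) → ℕ
    right t zero    = -1#
    right t (suc b) = δ t b

    factorizes : ∀ a b → δᶜ a b ≈ sum (λ t → δᶜ a (suc t) * right t b)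
    factorizes a (suc b) = ≈-sym (sum-δ (λ t → δᶜ a (suc t)) b)
    factorizes a zero    = ≈-sym (begin
      sum (λ t → δᶜ a (suc t) * -1#) ≈⟨ *-distribʳ-sum -1# (λ t → δᶜ a (suc t)) ⟨
      sum (λ t → δᶜ a (suc t)) * -1# ≡⟨ ℕ.*-comm _ -1# ⟩
      -1# * sum (λ t → δᶜ a (suc t)) ≈⟨ x+y≈0⇒-1#*x≈y rowSum≈0 ⟩
      δᶜ a zero                      ∎)
      where
      rowSum≈0 : sum (λ t → δᶜ a (suc t)) + δᶜ a zero ≈ 0
      rowSum≈0 = begin
        sum (λ t → δᶜ a (suc t)) + δᶜ a zero ≡⟨ ℕ.+-comm _ (δᶜ a zero) ⟩
        sum (δᶜ a)                           ≈⟨ sum-δᶜ a ⟩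
        s                                    ≈⟨ ∣⇒≈0 p∣s ⟩
        0                                    ∎

  1+-1#*δᶜ≈δ : ∀ {k} (i j : Fin k) → 1 + -1# * δᶜ i j ≈ δ i j
  1+-1#*δᶜ≈δ i j with i ≟ j
  ... | yes _ = ≡⇒≈ (cong suc (ℕ.*-zeroʳ -1#))
  ... | no  _ = -1#-inverse 1

  -- (J − I)(l J − I) = (l s − 1) J + I when J has size s + 1.
  δᶜ-minor : ∀ {s} l → l * s ≈ 1 → RightInvertibleMinor (δᶜ {suc s}) (suc s)
  δᶜ-minor {s} l ls≈1 = record
    { N              = suc s
    ; rows           = id
    ; cols           = id
    ; inverse        = λ j i′ → l + -1# * δ j i′
    ; isRightInverse = λ i i′ → begin
        sum (λ j → δᶜ i j * (l + -1# * δ j i′))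
          ≡⟨ sum-cong-≗ (λ j → expand (δᶜ i j) l -1# (δ j i′)) ⟩
        sum (λ j → l * δᶜ i j + -1# * (δᶜ i j * δ j i′))
          ≈⟨ ∑-distrib-+ (λ j → l * δᶜ i j) (λ j → -1# * (δᶜ i j * δ j i′)) ⟩
        sum (λ j → l * δᶜ i j) + sum (λ j → -1# * (δᶜ i j * δ j i′))
          ≈⟨ +-cong (*-distribˡ-sum l (δᶜ i)) (*-distribˡ-sum -1# (λ j → δᶜ i j * δ j i′)) ⟨
        l * sum (δᶜ i) + -1# * sum (λ j → δᶜ i j * δ j i′)
          ≈⟨ +-cong (*-congˡ {l} (sum-δᶜ i)) (*-congˡ { -1#} (sum-δ (δᶜ i) i′)) ⟩
        l * s + -1# * δᶜ i i′
          ≈⟨ +-congʳ { -1# * δᶜ i i′} ls≈1 ⟩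
        1 + -1# * δᶜ i i′
          ≈⟨ 1+-1#*δᶜ≈δ i i′ ⟩
        δ i i′ ∎
    }
    where
    expand : ∀ x l m y → x * (l + m * y) ≡ l * x + m * (x * y)
    expand = solve-∀

  δᶜ-minor-divisible : ∀ {s} → p ∣ s → RightInvertibleMinor (δᶜ {suc s}) s
  δᶜ-minor-divisible {zero}  _   = minor-zero
  δᶜ-minor-divisible {suc s} p∣s =
    minor-∘ suc suc (λ _ _ → refl) (δᶜ-minor -1# (x+y≈0⇒-1#*x≈y s+1≈0))
    where
    s+1≈0 : s + 1 ≈ 0
    s+1≈0 = ≈-trans (≡⇒≈ (ℕ.+-comm s 1)) (∣⇒≈0 p∣s)

  δᶜ-minor-nondivisible : Prime p → ∀ {s} → ¬ p ∣ s → RightInvertibleMinor (δᶜ {suc s}) (suc s)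
  δᶜ-minor-nondivisible p-prime p∤s =
    let l , ls≈1 = ≉0⇒invertible p-prime (p∤s ∘ ≈0⇒∣) in δᶜ-minor l ls≈1

  -- Rank of the compatibility matrix

  colorMatrix-factorization : ∀ {m n q r} → Factorization (δᶜ {q}) r →
    (E : List (Fin m × Fin n)) → Factorization (colorMatrix q E) (r ^ length E)
  colorMatrix-factorization F [] =
    record { left = λ _ _ → 1 ; right = λ _ _ → 1 ; factorizes = λ _ _ → ≈-refl }
  colorMatrix-factorization {q = q} F ((u , v) ∷ E) =
    factorization-∘ id id (colorMatrix-∷ q u v E)
      (factorization-⊙ (factorization-∘ (λ x → x u) (λ y → y v) (λ _ _ → refl) F)
                       (colorMatrix-factorization F E))

  -- On colourings that vary only at the endpoints of the first edge of a matching, the matrix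
  -- is the Kronecker product of J − I with the matrix of the remaining edges.
  colorMatrix-minor : ∀ {m n q s} → RightInvertibleMinor (δᶜ {q}) s →
    (Fin m → Fin q) → (Fin n → Fin q) → (E : List (Fin m × Fin n)) → Matching E →
    RightInvertibleMinor (colorMatrix q E) (s ^ length E)
  colorMatrix-minor B x₀ y₀ [] _ =
    record { N = 1 ; rows = λ _ → x₀ ; cols = λ _ → y₀ ; inverse = λ _ _ → 1
           ; isRightInverse = λ { zero zero → ≈-refl } }
  colorMatrix-minor {q = q} B x₀ y₀ ((u , v) ∷ E) (u∉E ∷ uniqueX , v∉E ∷ uniqueY) =
    minor-∘ (λ (a , x) → updateAt x u (const a)) (λ (b , y) → updateAt y v (const b))
      (λ (a , x) (b , y) → colorMatrix-updateAt q u∉E v∉E a b x y)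
      (minor-⊗ B (colorMatrix-minor B x₀ y₀ E (uniqueX , uniqueY)))

  colorMatrix-rankAtMost : Prime p → ∀ {m n} q (E : List (Fin m × Fin n)) →
    RankAtMost p (colorMatrix q E) (q ^ length E)
  colorMatrix-rankAtMost p-prime q E =
    factorization⇒rankAtMost p-prime (colorMatrix-factorization δᶜ-factorization E)

  colorMatrix-rankAtMost-divisible : Prime p → ∀ {m n} q (E : List (Fin m × Fin n)) →
    DividesPred p q → RankAtMost p (colorMatrix q E) ((q ∸ 1) ^ length E)
  colorMatrix-rankAtMost-divisible p-prime (suc s) E (_ , p∣s) =
    factorization⇒rankAtMost p-prime (colorMatrix-factorization (δᶜ-factorization-divisible p∣s) E)

  colorMatrix-rankAtLeast-divisible : ∀ {m n} q (E : List (Fin m × Fin n)) → IsPerfectMatching E →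
    DividesPred p q → RankAtLeast p (colorMatrix q E) ((q ∸ 1) ^ length E)
  colorMatrix-rankAtLeast-divisible (suc s) E perfect (_ , p∣s) = minor⇒rankAtLeast
    (colorMatrix-minor (δᶜ-minor-divisible p∣s) (const zero) (const zero) E
      (perfectMatching⇒matching perfect))

  colorMatrix-rankAtLeast-nondivisible : Prime p → ∀ {m n} q (E : List (Fin m × Fin n)) →
    IsPerfectMatching E → ¬ DividesPred p q → RankAtLeast p (colorMatrix q E) (q ^ length E)
  colorMatrix-rankAtLeast-nondivisible p-prime zero [] (degX≡1 , degY≡1) _ = minor⇒rankAtLeast
    (colorMatrix-minor minor-zero (λ u → contradiction (degX≡1 u) λ ()) (λ v → contradiction (degY≡1 v) λ ())
      [] ([] , []))
  colorMatrix-rankAtLeast-nondivisible p-prime zero E@(_ ∷ _) _ _ =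
    minor⇒rankAtLeast (minor-zero {M = colorMatrix 0 E})
  colorMatrix-rankAtLeast-nondivisible p-prime (suc s) E perfect ¬divides = minor⇒rankAtLeast
    (colorMatrix-minor (δᶜ-minor-nondivisible p-prime (¬divides ∘ (s≤s z≤n ,_))) (const zero) (const zero) E
      (perfectMatching⇒matching perfect))

lemma7 : (p q m n : ℕ) → Prime p → (E : List (Fin m × Fin n)) → Unique E →
    ((DividesPred p q → RankAtMost p (colorMatrix q E) ((q ∸ 1) ^ length E))
     × (¬ DividesPred p q → RankAtMost p (colorMatrix q E) (q ^ length E)))
    × (IsPerfectMatching E →
        (DividesPred p q → RankEq p (colorMatrix q E) ((q ∸ 1) ^ length E))
        × (¬ DividesPred p q → RankEq p (colorMatrix q E) (q ^ length E)))
lemma7 p q m n p-prime E _ =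
  (colorMatrix-rankAtMost-divisible p-prime q E , λ _ → colorMatrix-rankAtMost p-prime q E) ,
  λ perfect →
    (λ divides → colorMatrix-rankAtMost-divisible p-prime q E divides ,
                 colorMatrix-rankAtLeast-divisible q E perfect divides) ,
    (λ ¬divides → colorMatrix-rankAtMost p-prime q E ,
                  colorMatrix-rankAtLeast-nondivisible p-prime q E perfect ¬divides)
  where open Modulo p {{prime⇒nonZero p-prime}}
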